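{- Consider tilings with half-squares, fences and combs (defined in the context). Let $M$ be any mixed metatile. Then the arrangement $M'$ obtained from $M$ by swapping the contents of the left and right slots of each cell (each tooth is moved to the other slot of the same cell) is again a mixed metatile of the same length, and $M'\neq M$. Consequently the mixed metatiles fall into pairs $\{M,M'\}$, one member of each pair being obtained from the other by this swapping operation.
   Context: An $n$-board is a linear array of $n$ unit square cells; each cell is split into a left half and a right half, called slots (each of size $\frac12\times1$). For a positive integer $m$, a $(\frac12,\frac12;m)$-comb is a tile consisting of $m$ sub-tiles (teeth) of size $\frac12\times1$ in a row, consecutive teeth separated by gaps of size $\frac12\times1$; placed on a board it covers $m$ slots of the same kind (all left slots or all right slots) in $m$ consecutive cells, and its gaps may be filled by other tiles. A half-square ($h$), fence ($f$), and comb ($c$) are the $(\frac12,\frac12;m)$-combs with $m=1,2,3$ respectively. A tiling of an $n$-board covers every slot by exactly one tooth. A metatile of length $l$ is a tiling of an $l$-board by such tiles that cannot be split: for every $j$ with $1\le j\le l-1$ some tile has teeth both in cells $1,\dots,j$ and in cells $j+1,\dots,l$. (Every tiling of a board decomposes uniquely into consecutive metatiles.) A metatile is mixed if it contains more than one type of tile ($h$, $f$, $c$). -}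

module Defs where

open import Data.Nat using (ℕ; zero; suc; _+_; _≤_; _<_; _≤ᵇ_; _<ᵇ_)
open import Data.Bool using (Bool; true; false; _∧_; not)
open import Data.List using (List; []; _∷_; map; filter; length)
open import Data.List.Membership.Propositional using (_∈_)
open import Data.Product using (Σ; _×_; ∃-syntax)
open import Relation.Binary.PropositionalEquality using (_≡_; _≢_)
open import Relation.Nullary using (¬_)
open import Data.Bool.Properties using (T?)
open import Data.Bool using (T)

-- Cells of an n-board are numbered 0,…,n-1.  A slot is a pair (cell, side),
-- side = false for the left half, side = true for the right half.

-- A placed (½,½;m)-comb: m teeth, all on side `side`, in cells
-- start, start+1, …, start+m-1.  (m = 1 : half-square, 2 : fence, 3 : comb.)
record Tile : Set where
  constructor tile
  field
    teeth : ℕ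
    side  : Bool
    start : ℕ
open Tile public

sameSide : Bool → Bool → Bool
sameSide false false = true
sameSide true  true  = true
sameSide _     _     = false

covers : Tile → ℕ → Bool → Bool
covers t c s = sameSide (side t) s ∧ (start t ≤ᵇ c) ∧ (c <ᵇ start t + teeth t)

-- an arrangement of tiles is a finite list (multiset) of placed tiles
Arrangement : Set
Arrangement = List Tile

coverCount : Arrangement → ℕ → Bool → ℕ
coverCount ts c s = length (filter (λ t → T? (covers t c s)) ts)

WellPlaced : ℕ → Tile → Set
WellPlaced n t = 1 ≤ teeth t × teeth t ≤ 3 × start t + teeth t ≤ n

Tiling : ℕ → Arrangement → Set
Tiling n ts = (∀ {t} → t ∈ ts → WellPlaced n t)
            × (∀ c s → c < n → coverCount ts c s ≡ 1)

-- a metatile of length l: a tiling of an l-board which cannot be split: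
-- for every j with 1 ≤ j ≤ l-1 some tile has teeth both in cells 1..j and
-- in cells j+1..l (1-based), i.e. in 0-based cells: start ≤ j-1 and
-- start + teeth - 1 ≥ j.
Metatile : ℕ → Arrangement → Set
Metatile l ts = Tiling l ts
              × (∀ j → 1 ≤ j → j < l →
                   ∃[ t ] (t ∈ ts × start t < j × j < start t + teeth t))

-- mixed: contains more than one type of tile (types are determined by the
-- number of teeth)
Mixed : Arrangement → Set
Mixed ts = ∃[ t ] ∃[ u ] (t ∈ ts × u ∈ ts × teeth t ≢ teeth u)

swapTile : Tile → Tile
swapTile (tile m s i) = tile m (not s) i

swap : Arrangement → Arrangement
swap = map swapTile

{-# OPTIONS --safe #-}
-- If swap M were a rearrangement of M, then M would be closed under swapping,
-- so together with any tile it would contain the copy of that tile on the left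
-- side.  The tile t₀ covering the left slot of the first cell must then be the
-- left copy of every tile starting under it, and indecomposability at cell
-- teeth t₀ forces t₀ to span the whole board.  Hence every tile starts under
-- t₀ and has as many teeth as t₀, so M is not mixed.
module Submission where

open import Defs
open import Data.Nat using (ℕ; suc; _+_; _≤_; _<_; z≤n; s≤s)
open import Data.Nat.Properties
  using (≤ᵇ⇒≤; <ᵇ⇒<; ≤⇒≤ᵇ; <⇒<ᵇ; ≤-refl; ≤-trans; <-≤-trans; <-irrefl; ≤-antisym;
         ≮⇒≥; _<?_; n≤0⇒n≡0; m<m+n)
open import Data.Bool using (Bool; true; false; not; T)
open import Data.Bool.Properties using (T?; T-∧; not-involutive)
open import Data.Empty using (⊥-elim)
open import Data.List using (List; []; _∷_; map; length)
open import Data.List.Properties using (map-∘; map-cong; map-id)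
open import Data.List.Membership.Propositional using (_∈_)
open import Data.List.Membership.Propositional.Properties using (∈-map⁺; ∈-map⁻; ∈-filter⁺; ∈-filter⁻)
open import Data.List.Relation.Unary.Any using (here)
open import Data.List.Relation.Binary.Permutation.Propositional using (_↭_)
open import Data.List.Relation.Binary.Permutation.Propositional.Properties using (∈-resp-↭)
open import Data.Product using (_×_; _,_; proj₁; proj₂; ∃-syntax)
open import Function using (_∘_; id)
open import Function.Bundles using (Equivalence)
open import Relation.Nullary using (¬_; yes; no)
open import Relation.Binary.PropositionalEquality using (_≡_; refl; cong; sym; trans; subst)
open Relation.Binary.PropositionalEquality.≡-Reasoning

module _ {A : Set} where

  ∈-length≡1⇒≡ : ∀ {xs : List A} {x y} → length xs ≡ 1 → x ∈ xs → y ∈ xs → x ≡ y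
  ∈-length≡1⇒≡ {_ ∷ []} _ (here refl) (here refl) = refl

  length≡1⇒∃∈ : ∀ {xs : List A} → length xs ≡ 1 → ∃[ x ] x ∈ xs
  length≡1⇒∃∈ {x ∷ _} _ = x , here refl

Covers : Tile → ℕ → Bool → Set
Covers t c s = T (covers t c s)

covers⁺ : ∀ {t c s} → side t ≡ s → start t ≤ c → c < start t + teeth t → Covers t c s
covers⁺ {tile m false i} refl p q = Equivalence.from T-∧ (≤⇒≤ᵇ p , <⇒<ᵇ q)
covers⁺ {tile m true  i} refl p q = Equivalence.from T-∧ (≤⇒≤ᵇ p , <⇒<ᵇ q)

covers⁻ : ∀ t c s → Covers t c s → side t ≡ s × start t ≤ c × c < start t + teeth t
covers⁻ (tile m false i) c false h =
  let (p , q) = Equivalence.to T-∧ h in refl , ≤ᵇ⇒≤ i c p , <ᵇ⇒< c (i + m) q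
covers⁻ (tile m true  i) c true  h =
  let (p , q) = Equivalence.to T-∧ h in refl , ≤ᵇ⇒≤ i c p , <ᵇ⇒< c (i + m) q

covers-swapTile : ∀ t c s → covers (swapTile t) c s ≡ covers t c (not s)
covers-swapTile (tile m false i) c false = refl
covers-swapTile (tile m false i) c true  = refl
covers-swapTile (tile m true  i) c false = refl
covers-swapTile (tile m true  i) c true  = refl

coverCount-swap : ∀ M c s → coverCount (swap M) c s ≡ coverCount M c (not s)
coverCount-swap []      c s = refl
coverCount-swap (t ∷ M) c s
  with covers (swapTile t) c s | covers t c (not s) | covers-swapTile t c s
... | true  | true  | refl = cong suc (coverCount-swap M c s)
... | false | false | refl = coverCount-swap M c s

swapTile-involutive : ∀ t → swapTile (swapTile t) ≡ t
swapTile-involutive (tile m s i) = cong (λ s′ → tile m s′ i) (not-involutive s)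

swap-involutive : ∀ M → swap (swap M) ≡ M
swap-involutive M = begin
  swap (swap M)                  ≡⟨ map-∘ M ⟨
  map (swapTile ∘ swapTile) M    ≡⟨ map-cong swapTile-involutive M ⟩
  map id M                       ≡⟨ map-id M ⟩
  M                              ∎

metatile-swap : ∀ {l M} → Metatile l M → Metatile l (swap M)
metatile-swap {l} {M} ((placed , count) , indecomposable) =
  ((placed′ , count′) , indecomposable′)
  where
  placed′ : ∀ {w} → w ∈ swap M → WellPlaced l w
  placed′ w∈ with ∈-map⁻ swapTile w∈
  ... | tile _ _ _ , t∈ , refl = placed t∈

  count′ : ∀ c s → c < l → coverCount (swap M) c s ≡ 1
  count′ c s c<l = trans (coverCount-swap M c s) (count c (not s) c<l)

  indecomposable′ : ∀ j → 1 ≤ j → j < l →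
                    ∃[ w ] (w ∈ swap M × start w < j × j < start w + teeth w)
  indecomposable′ j 1≤j j<l with indecomposable j 1≤j j<l
  ... | tile m s i , t∈ , p , q = tile m (not s) i , ∈-map⁺ swapTile t∈ , p , q

mixed-swap : ∀ {M} → Mixed M → Mixed (swap M)
mixed-swap (tile m s i , tile m′ s′ i′ , t∈ , u∈ , m≢m′) =
  _ , _ , ∈-map⁺ swapTile t∈ , ∈-map⁺ swapTile u∈ , m≢m′

module _ {l M} (tiling : Tiling l M) where

  start<l : ∀ {t} → t ∈ M → start t < l
  start<l {t} t∈ = let (1≤m , _ , fits) = proj₁ tiling t∈ in
    <-≤-trans (m<m+n (start t) 1≤m) fits

  coveringTile : ∀ c s → c < l → ∃[ t ] (t ∈ M × Covers t c s)
  coveringTile c s c<l =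
    let (t , t∈) = length≡1⇒∃∈ (proj₂ tiling c s c<l) in
    t , ∈-filter⁻ (λ t → T? (covers t c s)) t∈

  coveringTile-unique : ∀ {t u c s} → t ∈ M → u ∈ M → c < l →
                        Covers t c s → Covers u c s → t ≡ u
  coveringTile-unique {c = c} {s} t∈ u∈ c<l ct cu =
    ∈-length≡1⇒≡ (proj₂ tiling c s c<l) (∈-filter⁺ P? t∈ ct) (∈-filter⁺ P? u∈ cu)
    where P? = λ t → T? (covers t c s)

SwapClosed : Arrangement → Set
SwapClosed M = ∀ {t} → t ∈ M → swapTile t ∈ M

↭-swap⇒swapClosed : ∀ {M} → swap M ↭ M → SwapClosed M
↭-swap⇒swapClosed p t∈ = ∈-resp-↭ p (∈-map⁺ swapTile t∈)

leftCopy : Tile → Tile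
leftCopy t = tile (teeth t) false (start t)

leftCopy-∈ : ∀ {M t} → SwapClosed M → t ∈ M → leftCopy t ∈ M
leftCopy-∈ {t = tile m false i} closed t∈ = t∈
leftCopy-∈ {t = tile m true  i} closed t∈ = closed t∈

swapClosed⇒uniform : ∀ {l M} → Metatile l M → SwapClosed M →
                     ∀ {t u} → t ∈ M → u ∈ M → teeth t ≡ teeth u
swapClosed⇒uniform {l} {M} (tiling , indecomposable) closed {t} t∈ u∈ =
  trans (teeth≡teeth₀ t∈) (sym (teeth≡teeth₀ u∈))
  where
  first = coveringTile tiling 0 false (≤-trans (s≤s z≤n) (start<l tiling t∈))
  t₀ = proj₁ first
  t₀∈ = proj₁ (proj₂ first)
  t₀-covers = covers⁻ t₀ 0 false (proj₂ (proj₂ first))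

  start₀ : start t₀ ≡ 0
  start₀ = n≤0⇒n≡0 (proj₁ (proj₂ t₀-covers))

  covers₀ : ∀ {c} → c < teeth t₀ → Covers t₀ c false
  covers₀ c<m = covers⁺ (proj₁ t₀-covers) (subst (_≤ _) (sym start₀) z≤n)
                        (subst (λ i → _ < i + teeth t₀) (sym start₀) c<m)

  leftCopy≡t₀ : ∀ {w} → w ∈ M → start w < teeth t₀ → leftCopy w ≡ t₀
  leftCopy≡t₀ {w} w∈ w<m =
    coveringTile-unique tiling (leftCopy-∈ closed w∈) t₀∈ (start<l tiling w∈)
      (covers⁺ {leftCopy w} refl ≤-refl (m<m+n (start w) (proj₁ (proj₁ tiling w∈))))
      (covers₀ w<m)

  spans : teeth t₀ ≡ l
  spans with teeth t₀ <? l
  ... | no m≮l = ≤-antisym (subst (λ i → i + teeth t₀ ≤ l) start₀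
                                  (proj₂ (proj₂ (proj₁ tiling t₀∈)))) (≮⇒≥ m≮l)
  ... | yes m<l with indecomposable (teeth t₀) (proj₁ (proj₁ tiling t₀∈)) m<l
  ... | v , v∈ , v<m , m<end = ⊥-elim (<-irrefl (sym end≡m) m<end)
    where
    v≡t₀ = leftCopy≡t₀ v∈ v<m
    end≡m : start v + teeth v ≡ teeth t₀
    end≡m = begin
      start v + teeth v    ≡⟨ cong (_+ teeth v) (trans (cong start v≡t₀) start₀) ⟩
      teeth v              ≡⟨ cong teeth v≡t₀ ⟩
      teeth t₀             ∎

  teeth≡teeth₀ : ∀ {w} → w ∈ M → teeth w ≡ teeth t₀
  teeth≡teeth₀ w∈ = cong teeth (leftCopy≡t₀ w∈ (subst (_ <_) (sym spans) (start<l tiling w∈)))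

lemma1 : ∀ (l : ℕ) (M : Arrangement) → Metatile l M → Mixed M →
    Metatile l (swap M) × Mixed (swap M) × ¬ (swap M ↭ M) × swap (swap M) ≡ M
lemma1 l M meta mixed@(t , u , t∈ , u∈ , t≢u) =
  metatile-swap meta ,
  mixed-swap mixed ,
  (λ p → t≢u (swapClosed⇒uniform meta (↭-swap⇒swapClosed p) t∈ u∈)) ,
  swap-involutive M
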